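{- Let $C$ be a layered arithmetic circuit of width $w$ and size $s$ computing a polynomial $p$ (over a field, with either commuting or noncommuting variables). Then there is a staggered arithmetic circuit $C'$ of width at most $w+1$ and size $O(ws)$ computing the same polynomial $p$.
   Context: An arithmetic circuit over a field $\mathbb{F}$ and variables $x_1,\dots,x_n$ is a directed acyclic graph whose indegree-zero nodes are labeled by variables or scalar constants and whose internal nodes are labeled $+$ or $\times$ and have indegree two; each gate computes the sum or product of its inputs, and a designated output gate gives the polynomial computed. The circuit is layered if its nodes are partitioned as $V_1\cup\dots\cup V_t$ where $V_1$ consists only of leaves and every internal node in $V_i$ ($i>1$) has children in $V_1$ or $V_{i-1}$. Size is the number of nodes; width of a layered circuit is $\max_{i>1}|V_i|$. A layered circuit is staggered if in each layer $i>1$ every node except possibly one is a product gate of the form $g=u\times 1$ for some gate $u$ of the previous layer. -}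

module Defs where

open import Level using (Level; Setω)
open import Data.Nat using (ℕ; zero; _+_; _⊔_)
  renaming (suc to sucℕ)
open import Data.Fin using (Fin)
open import Data.Vec using (Vec; lookup; toList)
open import Data.List using (List; []; _∷_; length)
open import Data.Bool using (Bool; true; false)
open import Data.Product using (Σ; ∃; _×_; _,_)
open import Data.Empty using (⊥)
open import Relation.Nullary using (¬_)
open import Relation.Binary.PropositionalEquality using (_≡_)
open import Algebra.Bundles using (CommutativeRing)

record Field (c ℓ : Level) : Set (Level.suc (c Level.⊔ ℓ)) where
  field
    commutativeRing : CommutativeRing c ℓ
  open CommutativeRing commutativeRing public
  field
    0≉1     : ¬ (0# ≈ 1#)
    inverse : ∀ x → ¬ (x ≈ 0#) → Σ Carrier λ y → (x * y) ≈ 1#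

-- A polynomial is a term modulo the axioms of (commutative or
-- noncommutative) F-algebras: this is the free (commutative) F-algebra
-- on n generators, i.e. F[x_1..x_n] resp. F<x_1..x_n>.
-- `comm = true` : commuting variables; `comm = false` : noncommuting.

module Poly {c ℓ} (F : Field c ℓ) (n : ℕ) where
  private module F = Field F

  data Term : Set c where
    var  : Fin n → Term
    cst  : F.Carrier → Term
    _⊕_  : Term → Term → Term
    _⊗_  : Term → Term → Term

  infixl 6 _⊕_
  infixl 7 _⊗_

  data _≈[_]_ : Term → Bool → Term → Set (c Level.⊔ ℓ) where
    refl    : ∀ {b p} → p ≈[ b ] p
    sym     : ∀ {b p q} → p ≈[ b ] q → q ≈[ b ] p
    trans   : ∀ {b p q r} → p ≈[ b ] q → q ≈[ b ] r → p ≈[ b ] r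
    ⊕-cong  : ∀ {b p p′ q q′} → p ≈[ b ] p′ → q ≈[ b ] q′ → (p ⊕ q) ≈[ b ] (p′ ⊕ q′)
    ⊗-cong  : ∀ {b p p′ q q′} → p ≈[ b ] p′ → q ≈[ b ] q′ → (p ⊗ q) ≈[ b ] (p′ ⊗ q′)
    cst-cong : ∀ {b x y} → x F.≈ y → cst x ≈[ b ] cst y
    cst-+    : ∀ {b x y} → (cst x ⊕ cst y) ≈[ b ] cst (x F.+ y)
    cst-*    : ∀ {b x y} → (cst x ⊗ cst y) ≈[ b ] cst (x F.* y)
    ⊕-assoc  : ∀ {b p q r} → ((p ⊕ q) ⊕ r) ≈[ b ] (p ⊕ (q ⊕ r))
    ⊕-comm   : ∀ {b p q} → (p ⊕ q) ≈[ b ] (q ⊕ p)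
    ⊕-idˡ    : ∀ {b p} → (cst F.0# ⊕ p) ≈[ b ] p
    ⊕-invʳ   : ∀ {b p} → (p ⊕ (cst (F.- F.1#) ⊗ p)) ≈[ b ] cst F.0#
    ⊗-assoc  : ∀ {b p q r} → ((p ⊗ q) ⊗ r) ≈[ b ] (p ⊗ (q ⊗ r))
    ⊗-idˡ    : ∀ {b p} → (cst F.1# ⊗ p) ≈[ b ] p
    ⊗-idʳ    : ∀ {b p} → (p ⊗ cst F.1#) ≈[ b ] p
    distribˡ : ∀ {b p q r} → (p ⊗ (q ⊕ r)) ≈[ b ] ((p ⊗ q) ⊕ (p ⊗ r))
    distribʳ : ∀ {b p q r} → ((q ⊕ r) ⊗ p) ≈[ b ] ((q ⊗ p) ⊕ (r ⊗ p))
    cst-central : ∀ {b x p} → (cst x ⊗ p) ≈[ b ] (p ⊗ cst x)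
    ⊗-comm   : ∀ {p q} → (p ⊗ q) ≈[ true ] (q ⊗ p)

module Circuits {c ℓ} (F : Field c ℓ) (n : ℕ) where
  private module F = Field F
  open Poly F n public

  -- labels of the leaves (layer V_1): a variable or a scalar constant
  data Leaf : Set c where
    var : Fin n → Leaf
    cst : F.Carrier → Leaf

  data Op : Set where
    plus times : Op

  -- a child of a gate in layer V_i (i>1): a leaf (an element of V_1,
  -- which has l nodes) or a node of V_{i-1} (which has m nodes).
  -- For i = 2, V_{i-1} = V_1 and `prev j` also denotes leaf j.
  data Child (l m : ℕ) : Set where
    leaf : Fin l → Child l m
    prev : Fin m → Child l m

  record Gate (l m : ℕ) : Set c where
    constructor gate
    field
      op    : Op
      left  : Child l m
      right : Child l m

  -- the internal layers V_2, ..., V_t on top of l leaves;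
  -- the index is the number of nodes of the last layer V_t
  -- (equal to l when t = 1).
  data Layers (l : ℕ) : ℕ → Set c where
    base : Layers l l
    _▷_  : ∀ {m k} → Layers l m → Vec (Gate l m) k → Layers l k

  infixl 5 _▷_

  data Node {l : ℕ} : ∀ {m} → Layers l m → Set c where
    leafN : Fin l → Node base
    top   : ∀ {m k} {L : Layers l m} {gs : Vec (Gate l m) k} → Fin k → Node (L ▷ gs)
    below : ∀ {m k} {L : Layers l m} {gs : Vec (Gate l m) k} → Node L → Node (L ▷ gs)

  record Circuit : Set c where
    constructor circuit
    field
      nLeaves : ℕ
      leaves  : Vec Leaf nLeaves
      topW    : ℕ
      layers  : Layers nLeaves topW
      output  : Node layers

  leafTerm : Leaf → Term
  leafTerm (var i) = var i
  leafTerm (cst a) = cst a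

  opTerm : Op → Term → Term → Term
  opTerm plus  = _⊕_
  opTerm times = _⊗_

  module _ {l : ℕ} (lv : Vec Leaf l) where
    topVal : ∀ {m} → Layers l m → Fin m → Term
    gateVal : ∀ {m} → Layers l m → Gate l m → Term
    childVal : ∀ {m} → Layers l m → Child l m → Term
    topVal base j = leafTerm (lookup lv j)
    topVal (L ▷ gs) j = gateVal L (lookup gs j)
    gateVal L (gate o a b) = opTerm o (childVal L a) (childVal L b)
    childVal L (leaf i) = leafTerm (lookup lv i)
    childVal L (prev j) = topVal L j

    nodeVal : ∀ {m} {L : Layers l m} → Node L → Term
    nodeVal (leafN i) = leafTerm (lookup lv i)
    nodeVal {L = L} (top j) = topVal L j
    nodeVal (below v) = nodeVal v

    -- number of internal nodes, and maximal layer size over layers i > 1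
    internalSize : ∀ {m} → Layers l m → ℕ
    internalSize base = 0
    internalSize (_▷_ {k = k} L gs) = internalSize L + k

    layersWidth : ∀ {m} → Layers l m → ℕ
    layersWidth base = 0
    layersWidth (_▷_ {k = k} L gs) = layersWidth L ⊔ k

    IsCopy : ∀ {m} → Gate l m → Set (c Level.⊔ ℓ)
    IsCopy g = (Gate.op g ≡ times)
             × (∃ λ j → Gate.left g ≡ prev j)
             × (∃ λ i → Gate.right g ≡ leaf i
                   × ∃ λ a → lookup lv i ≡ cst a × a F.≈ F.1#)

    StaggeredLayers : ∀ {m} → Layers l m → Set (c Level.⊔ ℓ)
    StaggeredLayers base = Level.Lift _ Data.Unit.⊤
      where import Data.Unit
    StaggeredLayers (_▷_ {k = k} L gs) =
      StaggeredLayers L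
      × (∀ (i j : Fin k) → ¬ IsCopy (lookup gs i) → ¬ IsCopy (lookup gs j) → i ≡ j)

  computes : Circuit → Term
  computes (circuit l lv _ L o) = nodeVal lv o

  size : Circuit → ℕ
  size (circuit l lv _ L o) = l + internalSize lv L

  width : Circuit → ℕ
  width (circuit l lv _ L o) = layersWidth lv L

  Staggered : Circuit → Set (c Level.⊔ ℓ)
  Staggered (circuit l lv _ L o) = StaggeredLayers lv L

-- An existential over ℕ whose body lives in Setω (needed because the
-- constant hidden in O(ws) must be uniform over all universe levels).

record ∃ℕω (P : ℕ → Setω) : Setω where
  constructor _,ω_
  field
    witness : ℕ
    proof   : P witness

SamePoly : ∀ {c ℓ} (F : Field c ℓ) (n : ℕ) (comm : Bool) →
           Poly.Term F n → Poly.Term F n → Set (c Level.⊔ ℓ)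
SamePoly F n comm p q = Poly._≈[_]_ F n p comm q

-- Each layer V_i of C is simulated by |V_i| consecutive layers of C′, each computing one gate of V_i
-- while copy gates u × 1 (with 1 an extra leaf) carry along the gates of V_i already computed and the
-- nodes of V_(i-1) still needed by the remaining gates.  The order of the gates is chosen greedily: if
-- a node of V_(i-1) is used by exactly one remaining gate, that gate goes next and frees the node;
-- otherwise every needed node is used at least twice and, gates having two inputs, there are at most
-- as many needed nodes as remaining gates.  Either way each layer of C′ has at most w + 1 nodes, so C′
-- has width w + 1 and at most (w + 1) s internal nodes.

module Submission where

open import Level using () renaming (_⊔_ to _⊔ℓ_)
open import Function using (id)
open import Data.Bool using (Bool)
open import Data.Nat using (ℕ; zero; suc; _+_; _*_; _≤_; _<_; _⊓_; _≤?_; _≟_; z≤n; s≤s)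
open import Data.Nat.Properties
open import Data.Nat.Solver using (module +-*-Solver)
open import Algebra.Properties.CommutativeSemigroup +-commutativeSemigroup using (interchange; x∙yz≈y∙xz)
open import Data.Fin using (Fin; zero; suc)
open import Data.Fin.Properties using (any?; toℕ<n)
open import Data.Vec as Vec using (Vec; []; _∷_; lookup)
open import Data.Vec.Properties using (lookup-map)
open import Data.List as List using (List; []; _∷_; _++_; length; filter; tabulate; allFin; removeAt)
open import Data.List.Properties using (length-removeAt′; length-tabulate; length-++; length-map)
open import Data.List.Membership.Propositional using (_∈_)
open import Data.List.Membership.Propositional.Properties
  using (∈-allFin; ∈-filter⁺; ∈-filter⁻; ∈-map⁺; ∈-++⁺ˡ; ∈-++⁺ʳ)
open import Data.List.Relation.Unary.Any using (here; there)
open import Data.List.Relation.Unary.All as All using (All; []; _∷_)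
import Data.List.Relation.Unary.All.Properties as All
open import Data.Product as Product using (Σ; _×_; _,_; proj₁; proj₂)
open import Data.Sum as Sum using (_⊎_; inj₁; inj₂)
open import Relation.Nullary using (¬_; contradiction; yes; no)
open import Relation.Binary.PropositionalEquality
  using (_≡_; _≢_; refl; sym; trans; cong; cong₂; subst; subst₂; module ≡-Reasoning)

open import Defs

∑ : ∀ {m} → (Fin m → ℕ) → ℕ
∑ {zero}  f = 0
∑ {suc m} f = f zero + ∑ λ v → f (suc v)

∑-const : ∀ m c → ∑ {m} (λ _ → c) ≡ m * c
∑-const zero    c = refl
∑-const (suc m) c = cong (c +_) (∑-const m c)

∑-zero : ∀ m → ∑ {m} (λ _ → 0) ≡ 0
∑-zero m = trans (∑-const m 0) (*-zeroʳ m)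

∑-mono-≤ : ∀ {m} {f g : Fin m → ℕ} → (∀ v → f v ≤ g v) → ∑ f ≤ ∑ g
∑-mono-≤ {zero}  f≤g = z≤n
∑-mono-≤ {suc m} f≤g = +-mono-≤ (f≤g zero) (∑-mono-≤ λ v → f≤g (suc v))

∑-mono-< : ∀ {m} {f g : Fin m → ℕ} → (∀ v → f v ≤ g v) → ∀ u → f u < g u → ∑ f < ∑ g
∑-mono-< f≤g zero    fu<gu = +-mono-<-≤ fu<gu (∑-mono-≤ λ v → f≤g (suc v))
∑-mono-< f≤g (suc u) fu<gu = +-mono-≤-< (f≤g zero) (∑-mono-< (λ v → f≤g (suc v)) u fu<gu)

∑-distrib-+ : ∀ {m} (f g : Fin m → ℕ) → ∑ (λ v → f v + g v) ≡ ∑ f + ∑ g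
∑-distrib-+ {zero}  f g = refl
∑-distrib-+ {suc m} f g =
  trans (cong (f zero + g zero +_) (∑-distrib-+ (λ v → f (suc v)) (λ v → g (suc v))))
        (interchange (f zero) (g zero) _ _)

∑-*ˡ : ∀ {m} c (f : Fin m → ℕ) → ∑ (λ v → c * f v) ≡ c * ∑ f
∑-*ˡ {zero}  c f = sym (*-zeroʳ c)
∑-*ˡ {suc m} c f =
  trans (cong (c * f zero +_) (∑-*ˡ c (λ v → f (suc v)))) (sym (*-distribˡ-+ c (f zero) _))

δ : ∀ {m} → Fin m → Fin m → ℕ
δ zero    zero    = 1
δ zero    (suc _) = 0
δ (suc _) zero    = 0
δ (suc u) (suc v) = δ u v

δ-diag : ∀ {m} (u : Fin m) → δ u u ≡ 1
δ-diag zero    = refl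
δ-diag (suc u) = δ-diag u

∑-δ : ∀ {m} (u : Fin m) → ∑ (δ u) ≡ 1
∑-δ {suc m} zero    = cong suc (∑-zero m)
∑-δ {suc m} (suc u) = ∑-δ u

support : ∀ {m} → (Fin m → ℕ) → List (Fin m)
support {m} f = filter (λ v → 1 ≤? f v) (allFin m)

length-support : ∀ {m} (f : Fin m → ℕ) → length (support f) ≡ ∑ λ v → 1 ⊓ f v
length-support {m} f = go (λ v → v)
  where
  go : ∀ {k} (g : Fin k → Fin m) → length (filter (λ v → 1 ≤? f v) (tabulate g)) ≡ ∑ λ v → 1 ⊓ f (g v)
  go {zero}  g = refl
  go {suc k} g with f (g zero)
  ... | zero  = go (λ v → g (suc v))
  ... | suc _ = cong suc (go (λ v → g (suc v)))

∈-support⁺ : ∀ {m} (f : Fin m → ℕ) {v} → 0 < f v → v ∈ support f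
∈-support⁺ f {v} = ∈-filter⁺ (λ u → 1 ≤? f u) (∈-allFin v)

∈-support⁻ : ∀ {m} (f : Fin m → ℕ) {v} → v ∈ support f → 0 < f v
∈-support⁻ {m} f v∈ = proj₂ (∈-filter⁻ (λ u → 1 ≤? f u) {xs = allFin m} v∈)

∈-removeAt⁻ : ∀ {A : Set} {x : A} (xs : List A) i → x ∈ xs → x ≡ List.lookup xs i ⊎ x ∈ removeAt xs i
∈-removeAt⁻ (y ∷ xs) zero    (here x≡y)  = inj₁ x≡y
∈-removeAt⁻ (y ∷ xs) zero    (there x∈xs) = inj₂ x∈xs
∈-removeAt⁻ (y ∷ xs) (suc i) (here x≡y)  = inj₂ (here x≡y)
∈-removeAt⁻ (y ∷ xs) (suc i) (there x∈xs) = Sum.map₂ there (∈-removeAt⁻ xs i x∈xs)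

module Scheduling {k m : ℕ} (uses : Fin k → Fin m → ℕ) (∑-uses-≤2 : ∀ j → ∑ (uses j) ≤ 2) where

  deg : List (Fin k) → Fin m → ℕ
  deg []      v = 0
  deg (j ∷ R) v = uses j v + deg R v

  -- The number of nodes used by some gate of R (1 ⊓ d is the indicator of d > 0).
  need : List (Fin k) → ℕ
  need R = ∑ λ v → 1 ⊓ deg R v

  deg-removeAt : ∀ R q v → deg R v ≡ uses (List.lookup R q) v + deg (removeAt R q) v
  deg-removeAt (j ∷ R) zero    v = refl
  deg-removeAt (j ∷ R) (suc q) v =
    trans (cong (uses j v +_) (deg-removeAt R q v)) (x∙yz≈y∙xz (uses j v) (uses (List.lookup R q) v) (deg (removeAt R q) v))

  uses-lookup-≤-deg : ∀ R q v → uses (List.lookup R q) v ≤ deg R v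
  uses-lookup-≤-deg R q v = ≤-trans (m≤m+n _ _) (≤-reflexive (sym (deg-removeAt R q v)))

  deg-removeAt-≤ : ∀ R q v → deg (removeAt R q) v ≤ deg R v
  deg-removeAt-≤ R q v = ≤-trans (m≤n+m _ _) (≤-reflexive (sym (deg-removeAt R q v)))

  need-≤ : ∀ R → need R ≤ m
  need-≤ R = ≤-trans (∑-mono-≤ (λ v → m⊓n≤m 1 (deg R v))) (≤-reflexive (trans (∑-const m 1) (*-identityʳ m)))

  no-uses⇒need≡0 : (∀ j v → uses j v ≡ 0) → ∀ R → need R ≡ 0
  no-uses⇒need≡0 unused R = n≤0⇒n≡0 (≤-trans (∑-mono-≤ λ v → ≤-reflexive (cong (1 ⊓_) (deg≡0 R v)))
                                             (≤-reflexive (∑-zero m)))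
    where
    deg≡0 : ∀ R v → deg R v ≡ 0
    deg≡0 []      v = refl
    deg≡0 (j ∷ R) v = cong₂ _+_ (unused j v) (deg≡0 R v)

  need-removeAt-≤ : ∀ R q → need (removeAt R q) ≤ need R
  need-removeAt-≤ R q = ∑-mono-≤ λ v → ⊓-monoʳ-≤ 1 (deg-removeAt-≤ R q v)

  need-removeAt-< : ∀ R q v → deg R v ≡ 1 → 0 < uses (List.lookup R q) v → need (removeAt R q) < need R
  need-removeAt-< R q v degR≡1 used = ∑-mono-< (λ u → ⊓-monoʳ-≤ 1 (deg-removeAt-≤ R q u)) v
      (subst₂ (λ a b → 1 ⊓ a < 1 ⊓ b) (sym deg′≡0) (sym degR≡1) (s≤s z≤n))
    where
    only-use : ∀ a b → 0 < a → a + b ≡ 1 → b ≡ 0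
    only-use (suc zero) b _ a+b≡1 = suc-injective a+b≡1
    deg′≡0 : deg (removeAt R q) v ≡ 0
    deg′≡0 = only-use _ _ used (trans (sym (deg-removeAt R q v)) degR≡1)

  ∑-deg : ∀ R → ∑ (deg R) ≤ 2 * length R
  ∑-deg []      = ≤-reflexive (∑-zero m)
  ∑-deg (j ∷ R) = begin
    ∑ (λ v → uses j v + deg R v)  ≡⟨ ∑-distrib-+ (uses j) (deg R) ⟩
    ∑ (uses j) + ∑ (deg R)        ≤⟨ +-mono-≤ (∑-uses-≤2 j) (∑-deg R) ⟩
    2 + 2 * length R              ≡⟨ sym (*-suc 2 (length R)) ⟩
    2 * length (j ∷ R)            ∎
    where open ≤-Reasoning

  need-≤-length : ∀ R → (∀ v → deg R v ≢ 1) → need R ≤ length R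
  need-≤-length R no-single = *-cancelˡ-≤ 2 (begin
    2 * need R                   ≡⟨ sym (∑-*ˡ 2 (λ v → 1 ⊓ deg R v)) ⟩
    ∑ (λ v → 2 * (1 ⊓ deg R v))  ≤⟨ ∑-mono-≤ (λ v → twice-⊓-≤ (deg R v) (no-single v)) ⟩
    ∑ (deg R)                    ≤⟨ ∑-deg R ⟩
    2 * length R                 ∎)
    where
    open ≤-Reasoning
    twice-⊓-≤ : ∀ d → d ≢ 1 → 2 * (1 ⊓ d) ≤ d
    twice-⊓-≤ zero          _   = z≤n
    twice-⊓-≤ (suc zero)    d≢1 = contradiction refl d≢1
    twice-⊓-≤ (suc (suc d)) _   = s≤s (s≤s z≤n)

  user : ∀ R v → 0 < deg R v → Σ (Fin (length R)) λ q → 0 < uses (List.lookup R q) v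
  user (j ∷ R) v used with uses j v in eq
  ... | suc _ = zero , ≤-trans (s≤s z≤n) (≤-reflexive (sym eq))
  ... | zero  = Product.map suc id (user R v used)

  -- If some node is used exactly once, dropping its user frees it; otherwise double counting bounds the need.
  cheap-removal : ∀ j R → Σ (Fin (suc (length R))) λ q →
                  need (removeAt (j ∷ R) q) < need (j ∷ R) ⊎ need (removeAt (j ∷ R) q) ≤ length (j ∷ R)
  cheap-removal j R with any? (λ v → deg (j ∷ R) v ≟ 1)
  ... | yes (v , single) = let q , used = user (j ∷ R) v (≤-reflexive (sym single)) in
                           q , inj₁ (need-removeAt-< (j ∷ R) q v single used)
  ... | no ¬single = zero , inj₂ (≤-trans (need-removeAt-≤ (j ∷ R) zero)
                                          (need-≤-length (j ∷ R) λ v single → ¬single (v , single)))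

  -- An order in which to process the gates R when d gates are already done, such that each step's
  -- layer (the new gate, copies of the d earlier ones and of the nodes still needed) has at most w + 1 nodes.
  data Schedule (w : ℕ) : ℕ → List (Fin k) → Set where
    []   : ∀ {d} → Schedule w d []
    pick : ∀ {d R} (q : Fin (length R)) → suc d + need (removeAt R q) ≤ suc w →
           Schedule w (suc d) (removeAt R q) → Schedule w d R

  schedule : ∀ {w} d R → d + length R ≤ w → d + need R ≤ suc w → Schedule w d R
  schedule d R = go (length R) d R refl
    where
    go : ∀ {w} n d R → length R ≡ n → d + length R ≤ w → d + need R ≤ suc w → Schedule w d R
    go n       d []      _ _ _ = []
    go {w} (suc n) d (j ∷ R) len fits-gates fits-need with cheap-removal j R
    ... | q , cheaper = pick q fits (go n (suc d) (removeAt (j ∷ R) q) len′ fits-gates′ fits)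
      where
      len′ : length (removeAt (j ∷ R) q) ≡ n
      len′ = suc-injective (trans (sym (length-removeAt′ (j ∷ R) q)) len)
      fits-gates′ : suc d + length (removeAt (j ∷ R) q) ≤ w
      fits-gates′ = ≤-trans (≤-reflexive (trans (sym (+-suc d _)) (cong (d +_) (sym (length-removeAt′ (j ∷ R) q)))))
                            fits-gates
      fits : suc d + need (removeAt (j ∷ R) q) ≤ suc w
      fits = Sum.[ (λ fewer → ≤-trans (+-monoʳ-< d fewer) fits-need)
                 , (λ few → ≤-trans (+-monoʳ-≤ (suc d) few) (s≤s fits-gates)) ]′ cheaper

*-+-suc : ∀ a b c → a * (b + c) + a ≡ a * (b + suc c)
*-+-suc a b c = begin
  a * (b + c) + a    ≡⟨ +-comm _ a ⟩
  a + a * (b + c)    ≡⟨ sym (*-suc a (b + c)) ⟩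
  a * suc (b + c)    ≡⟨ cong (a *_) (sym (+-suc b c)) ⟩
  a * (b + suc c)    ∎
  where open ≡-Reasoning

size-bound : ∀ l I w → 1 ≤ w → suc l + suc w * I ≤ 2 * (w * (l + I)) + 2
size-bound l I (suc w) _ = ≤-trans (m≤m+n _ (l + 1 + 2 * w * l + w * I)) (≤-reflexive equation)
  where
  open +-*-Solver
  equation : suc l + suc (suc w) * I + (l + 1 + 2 * w * l + w * I) ≡ 2 * (suc w * (l + I)) + 2
  equation = solve 3 (λ l I w → con 1 :+ l :+ (con 2 :+ w) :* I :+ (l :+ con 1 :+ con 2 :* w :* l :+ w :* I)
                              := con 2 :* ((con 1 :+ w) :* (l :+ I)) :+ con 2) refl l I w

module Staggering {c ℓ} (F : Field c ℓ) (comm : Bool) (n : ℕ) where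
  open Circuits F n
    using ( Term; Leaf; cst; plus; times; Child; leaf; prev; Gate; gate; Layers; base; _▷_
          ; Node; leafN; top; below; Circuit; circuit; opTerm; topVal; gateVal; childVal; nodeVal
          ; internalSize; layersWidth; IsCopy; StaggeredLayers; Staggered; computes; size; width )
  private
    module F = Field F
    module P = Circuits F n

  _≋_ : Term → Term → Set (c ⊔ℓ ℓ)
  _≋_ = SamePoly F n comm

  opTerm-cong : ∀ o {p p′ q q′} → p′ ≋ p → q′ ≋ q → opTerm o p′ q′ ≋ opTerm o p q
  opTerm-cong plus  = P.⊕-cong
  opTerm-cong times = P.⊗-cong

  childUses : ∀ {l m} → Child l m → Fin m → ℕ
  childUses (leaf _) _ = 0
  childUses (prev u) v = δ u v

  gateUses : ∀ {l m} → Gate l m → Fin m → ℕ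
  gateUses (gate _ a b) v = childUses a v + childUses b v

  ∑-gateUses : ∀ {l m} (g : Gate l m) → ∑ (gateUses g) ≤ 2
  ∑-gateUses {m = m} (gate _ a b) = ≤-trans (≤-reflexive (∑-distrib-+ (childUses a) (childUses b)))
                                            (+-mono-≤ (∑-childUses a) (∑-childUses b))
    where
    ∑-childUses : ∀ {l} (x : Child l m) → ∑ (childUses x) ≤ 1
    ∑-childUses (leaf _) = ≤-trans (≤-reflexive (∑-zero m)) z≤n
    ∑-childUses (prev u) = ≤-reflexive (∑-δ u)

  -- Over the leaf layer, prev i is the leaf i; rewriting it as leaf i means that no node of V_1
  -- has to be carried along by copy gates.
  leafChild : ∀ {l} → Child l l → Child l l
  leafChild (leaf i) = leaf i
  leafChild (prev i) = leaf i

  leafGate : ∀ {l} → Gate l l → Gate l l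
  leafGate (gate o a b) = gate o (leafChild a) (leafChild b)

  gateUses-leafGate : ∀ {l} (g : Gate l l) v → gateUses (leafGate g) v ≡ 0
  gateUses-leafGate (gate o a b) v = cong₂ _+_ (childUses-leafChild a) (childUses-leafChild b)
    where
    childUses-leafChild : ∀ x → childUses (leafChild x) v ≡ 0
    childUses-leafChild (leaf _) = refl
    childUses-leafChild (prev _) = refl

  gateVal-leafGate : ∀ {l} (lv : Vec Leaf l) (g : Gate l l) → gateVal lv base (leafGate g) ≡ gateVal lv base g
  gateVal-leafGate lv (gate o a b) = cong₂ (opTerm o) (childVal-leafChild a) (childVal-leafChild b)
    where
    childVal-leafChild : ∀ x → childVal lv base (leafChild x) ≡ childVal lv base x
    childVal-leafChild (leaf _) = refl
    childVal-leafChild (prev _) = refl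

  unique-non-copy : ∀ {l m k} {lv : Vec Leaf l} (g : Gate l m) (gs : Vec (Gate l m) k) →
                    (∀ i → IsCopy lv (lookup gs i)) →
                    ∀ i j → ¬ IsCopy lv (lookup (g ∷ gs) i) → ¬ IsCopy lv (lookup (g ∷ gs) j) → i ≡ j
  unique-non-copy g gs copy zero    zero    _     _     = refl
  unique-non-copy g gs copy (suc i) _       ¬copy _     = contradiction (copy i) ¬copy
  unique-non-copy g gs copy zero    (suc j) _     ¬copy = contradiction (copy j) ¬copy

  topNode : ∀ {l r} (L : Layers l r) → Fin r → Node L
  topNode base     p = leafN p
  topNode (L ▷ gs) p = top p

  nodeVal-topNode : ∀ {l r} (lv : Vec Leaf l) (L : Layers l r) p → nodeVal lv (topNode L p) ≡ topVal lv L p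
  nodeVal-topNode lv base     p = refl
  nodeVal-topNode lv (L ▷ gs) p = refl

  record Prefix {l} (lv : Vec Leaf l) {m} (L : Layers l m) (t : Term) : Set c where
    constructor prefix
    field
      r        : ℕ
      layers   : Layers l r
      position : Fin r
      value    : topVal lv layers position ≡ t
      size-≤   : internalSize lv layers ≤ internalSize lv L
      width-≤  : layersWidth lv layers ≤ layersWidth lv L

  prefixAt : ∀ {l} (lv : Vec Leaf l) {m} {L : Layers l m} (o : Node L) → Prefix lv L (nodeVal lv o)
  prefixAt lv (leafN i) = prefix _ base i refl z≤n z≤n
  prefixAt lv (top {L = L} {gs = gs} j) = prefix _ (L ▷ gs) j refl ≤-refl ≤-refl
  prefixAt lv (below {k = k} o) with prefixAt lv o
  ... | prefix r L j value size-≤ width-≤ =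
        prefix r L j value (≤-trans size-≤ (m≤m+n _ k)) (≤-trans width-≤ (m≤m⊔n _ k))

  module _ {l} (lv : Vec Leaf l) where

    -- The simulating circuit has the extra leaf 1 in front, for the copy gates u × 1.
    lv′ : Vec Leaf (suc l)
    lv′ = cst F.1# ∷ lv

    Available : ∀ {r} → Layers (suc l) r → Term → Set (c ⊔ℓ ℓ)
    Available {r} L′ t = Σ (Fin r) λ p → topVal lv′ L′ p ≋ t

    translateGate : ∀ {m r} {L : Layers l m} {L′ : Layers (suc l) r} (g : Gate l m) →
                    (∀ v → 0 < gateUses g v → Available L′ (topVal lv L v)) →
                    Σ (Gate (suc l) r) λ g′ → gateVal lv′ L′ g′ ≋ gateVal lv L g
    translateGate {m} {r} {L} {L′} (gate o a b) available =
      let a′ , a′≋a = translateChild a λ v used → available v (≤-trans used (m≤m+n _ _))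
          b′ , b′≋b = translateChild b λ v used → available v (≤-trans used (m≤n+m _ _))
      in gate o a′ b′ , opTerm-cong o a′≋a b′≋b
      where
      translateChild : (x : Child l m) → (∀ v → 0 < childUses x v → Available L′ (topVal lv L v)) →
                       Σ (Child (suc l) r) λ x′ → childVal lv′ L′ x′ ≋ childVal lv L x
      translateChild (leaf i) _ = leaf (suc i) , P.refl
      translateChild (prev v) available =
        let p , p≋v = available v (≤-reflexive (sym (δ-diag v))) in prev p , p≋v

    copyOf : ∀ {r} → Fin r → Gate (suc l) r
    copyOf p = gate times (prev p) (leaf zero)

    copies : ∀ {r} (L′ : Layers (suc l) r) {T} → All (Available L′) T → Vec (Gate (suc l) r) (length T)
    copies L′ []             = []
    copies L′ ((p , _) ∷ ps) = copyOf p ∷ copies L′ ps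

    copies-isCopy : ∀ {r} (L′ : Layers (suc l) r) {T} (ps : All (Available L′) T) i →
                    IsCopy lv′ (lookup (copies L′ ps) i)
    copies-isCopy L′ ((p , _) ∷ ps) zero    = refl , (p , refl) , (zero , refl , F.1# , refl , F.refl)
    copies-isCopy L′ (_ ∷ ps)       (suc i) = copies-isCopy L′ ps i

    withCopies : ∀ {r} (L′ : Layers (suc l) r) (g : Gate (suc l) r) {T} → All (Available L′) T →
                 Layers (suc l) (suc (length T))
    withCopies L′ g ps = L′ ▷ (g ∷ copies L′ ps)

    withCopies-staggered : ∀ {r} {L′ : Layers (suc l) r} (g : Gate (suc l) r) {T} (ps : All (Available L′) T) →
                           StaggeredLayers lv′ L′ → StaggeredLayers lv′ (withCopies L′ g ps)
    withCopies-staggered {L′ = L′} g ps staggered =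
      staggered , unique-non-copy {lv = lv′} g (copies L′ ps) (copies-isCopy L′ ps)

    available-copies : ∀ {r} (L′ : Layers (suc l) r) (g : Gate (suc l) r) {T} (ps : All (Available L′) T) {t} →
                       t ∈ T → Available (withCopies L′ g ps) t
    available-copies L′ g ps t∈T = let i , i≋t = go ps t∈T in suc i , i≋t
      where
      go : ∀ {T} (ps : All (Available L′) T) {t} → t ∈ T → Σ _ λ i → gateVal lv′ L′ (lookup (copies L′ ps) i) ≋ t
      go ((p , p≋t) ∷ _) (here refl) = zero , P.trans P.⊗-idʳ p≋t
      go (_ ∷ ps)        (there t∈T) = let i , i≋t = go ps t∈T in suc i , i≋t

    module _ (w : ℕ) where

      record Simulation {m} (L : Layers l m) : Set (c ⊔ℓ ℓ) where
        field
          r         : ℕ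
          layers′   : Layers (suc l) r
          staggered : StaggeredLayers lv′ layers′
          narrow    : layersWidth lv′ layers′ ≤ suc w
          small     : internalSize lv′ layers′ ≤ suc w * internalSize lv L
          available : ∀ v → Available layers′ (topVal lv L v)

      simulateLeaves : Simulation base
      simulateLeaves = record
        { r = suc l ; layers′ = base ; staggered = _ ; narrow = z≤n ; small = z≤n
        ; available = λ v → suc v , P.refl }

      module LayerStep {m k} (L : Layers l m) (gs : Vec (Gate l m) k) where
        open Scheduling (λ j → gateUses (lookup gs j)) (λ j → ∑-gateUses (lookup gs j)) public

        record Progress (d : ℕ) (R : List (Fin k)) : Set (c ⊔ℓ ℓ) where
          field
            r                : ℕ
            layers′          : Layers (suc l) r
            staggered        : StaggeredLayers lv′ layers′
            narrow           : layersWidth lv′ layers′ ≤ suc w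
            small            : internalSize lv′ layers′ ≤ suc w * (internalSize lv L + d)
            counted          : d + length R ≡ k
            values           : List Term
            length-values    : length values ≡ d
            values-available : All (Available layers′) values
            covered          : ∀ j → j ∈ R ⊎ topVal lv (L ▷ gs) j ∈ values
            needed-available : ∀ v → 0 < deg R v → Available layers′ (topVal lv L v)

        start : Simulation L → Progress 0 (allFin k)
        start sim = record
          { r = r ; layers′ = layers′ ; staggered = staggered ; narrow = narrow
          ; small = ≤-trans small (≤-reflexive (cong (suc w *_) (sym (+-identityʳ _))))
          ; counted = length-tabulate id
          ; values = [] ; length-values = refl ; values-available = []
          ; covered = λ j → inj₁ (∈-allFin j)
          ; needed-available = λ v _ → available v }
          where open Simulation sim

        advance : ∀ {d R} → Progress d R → (q : Fin (length R)) → suc d + need (removeAt R q) ≤ suc w →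
                  Progress (suc d) (removeAt R q)
        advance {d} {R} P q fits = record
          { r = suc (length T)
          ; layers′ = withCopies layers′ g′ T-available
          ; staggered = withCopies-staggered g′ T-available staggered
          ; narrow = ⊔-lub narrow new-width
          ; small = ≤-trans (+-mono-≤ small new-width) (≤-reflexive (*-+-suc (suc w) (internalSize lv L) d))
          ; counted = trans (sym (+-suc d _)) (trans (cong (d +_) (sym (length-removeAt′ R q))) counted)
          ; values = topVal lv (L ▷ gs) j ∷ values
          ; length-values = cong suc length-values
          ; values-available = (zero , g′≋g) ∷ All.tabulate (λ t∈ → new-available (∈-++⁺ˡ t∈))
          ; covered = covered′
          ; needed-available = λ v used →
              new-available (∈-++⁺ʳ values (∈-map⁺ (topVal lv L) (∈-support⁺ (deg R′) used)))
          }
          where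
          open Progress P
          j : Fin k
          j = List.lookup R q
          R′ : List (Fin k)
          R′ = removeAt R q
          T : List Term
          T = values ++ List.map (topVal lv L) (support (deg R′))
          T-available : All (Available layers′) T
          T-available = All.++⁺ values-available (All.map⁺ (All.tabulate λ {v} v∈ →
            needed-available v (≤-trans (∈-support⁻ (deg R′) v∈) (deg-removeAt-≤ R q v))))
          length-T : length T ≡ d + need R′
          length-T = trans (length-++ values)
                           (cong₂ _+_ length-values (trans (length-map _ (support (deg R′))) (length-support (deg R′))))
          translated : Σ (Gate (suc l) r) λ g′ → gateVal lv′ layers′ g′ ≋ gateVal lv L (lookup gs j)
          translated = translateGate (lookup gs j) λ v used → needed-available v (≤-trans used (uses-lookup-≤-deg R q v))
          g′ : Gate (suc l) r
          g′ = proj₁ translated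
          g′≋g : gateVal lv′ layers′ g′ ≋ gateVal lv L (lookup gs j)
          g′≋g = proj₂ translated
          new-width : suc (length T) ≤ suc w
          new-width = ≤-trans (s≤s (≤-reflexive length-T)) fits
          new-available : ∀ {t} → t ∈ T → Available (withCopies layers′ g′ T-available) t
          new-available = available-copies layers′ g′ T-available
          covered′ : ∀ j′ → j′ ∈ R′ ⊎ topVal lv (L ▷ gs) j′ ∈ topVal lv (L ▷ gs) j ∷ values
          covered′ j′ with covered j′
          ... | inj₂ done = inj₂ (there done)
          ... | inj₁ j′∈R with ∈-removeAt⁻ R q j′∈R
          ...   | inj₁ refl = inj₂ (here refl)
          ...   | inj₂ j′∈R′ = inj₁ j′∈R′

        finish : ∀ {d} → Progress d [] → Simulation (L ▷ gs)
        finish {d} P = record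
          { r = r ; layers′ = layers′ ; staggered = staggered ; narrow = narrow
          ; small = subst (λ e → internalSize lv′ layers′ ≤ suc w * (internalSize lv L + e))
                          (trans (sym (+-identityʳ d)) counted) small
          ; available = λ j → All.lookup values-available (Sum.[ (λ ()) , id ]′ (covered j)) }
          where open Progress P

        run : ∀ {d R} → Schedule w d R → Progress d R → Simulation (L ▷ gs)
        run []              P = finish P
        run (pick q fits S) P = run S (advance P q fits)

        simulateLayer : Simulation L → k ≤ w → need (allFin k) ≤ w → Simulation (L ▷ gs)
        simulateLayer sim k≤w need≤w =
          run (schedule 0 (allFin k) (≤-trans (≤-reflexive (length-tabulate id)) k≤w) (m≤n⇒m≤1+n need≤w)) (start sim)

      simulateOverLeaves : ∀ {k} (gs : Vec (Gate l l) k) → k ≤ w → Simulation (base ▷ gs)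
      simulateOverLeaves {k} gs k≤w = record
        { r = r ; layers′ = layers′ ; staggered = staggered ; narrow = narrow ; small = small
        ; available = λ j → let p , p≋ = available j in p , subst (topVal lv′ layers′ p ≋_) (leafGate-value j) p≋ }
        where
        gs′ : Vec (Gate l l) k
        gs′ = Vec.map leafGate gs
        open LayerStep base gs′ using (simulateLayer; no-uses⇒need≡0)
        unused : ∀ j v → gateUses (lookup gs′ j) v ≡ 0
        unused j v = trans (cong (λ g → gateUses g v) (lookup-map j leafGate gs)) (gateUses-leafGate (lookup gs j) v)
        open Simulation (simulateLayer simulateLeaves k≤w (≤-trans (≤-reflexive (no-uses⇒need≡0 unused (allFin k))) z≤n))
        leafGate-value : ∀ j → gateVal lv base (lookup gs′ j) ≡ gateVal lv base (lookup gs j)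
        leafGate-value j = trans (cong (gateVal lv base) (lookup-map j leafGate gs)) (gateVal-leafGate lv (lookup gs j))

      simulate : ∀ {m} (L : Layers l m) → layersWidth lv L ≤ w → Simulation L
      simulate base _ = simulateLeaves
      simulate (_▷_ {k = k} base gs) width≤w = simulateOverLeaves gs (≤-trans (m≤n⊔m 0 k) width≤w)
      simulate (_▷_ {k = k} (_▷_ {k = m} L hs) gs) width≤w =
        simulateLayer (simulate (L ▷ hs) prev-width≤w) (≤-trans (m≤n⊔m _ k) width≤w)
                       (≤-trans (need-≤ (allFin k)) (≤-trans (m≤n⊔m _ m) prev-width≤w))
        where
        open LayerStep (L ▷ hs) gs using (simulateLayer; need-≤)
        prev-width≤w : layersWidth lv (L ▷ hs) ≤ w
        prev-width≤w = ≤-trans (m≤m⊔n _ k) width≤w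

  stagger : (C : Circuit) → Σ Circuit λ C′ →
            Staggered C′ × width C′ ≤ suc (width C) × size C′ ≤ 2 * (width C * size C) + 2
            × computes C′ ≋ computes C
  stagger (circuit l lv _ L o) with prefixAt lv o
  ... | prefix _ base j value _ _ =
        circuit 1 (lookup lv j ∷ []) 1 base (leafN zero) , _ , z≤n , ≤-trans (s≤s z≤n) (m≤n+m 2 _) ,
        subst (_ ≋_) value P.refl
  ... | prefix _ (_▷_ {k = k} L₀ gs) j value size-≤ width-≤ =
        circuit (suc l) (lv′ lv) r layers′ (topNode layers′ p) , staggered , narrow ,
        ≤-trans (+-monoʳ-≤ (suc l) (≤-trans small (*-monoʳ-≤ (suc w) size-≤))) (size-bound l _ w w≥1) ,
        subst₂ _≋_ (sym (nodeVal-topNode (lv′ lv) layers′ p)) value p≋j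
    where
    w : ℕ
    w = layersWidth lv L
    open Simulation (simulate lv w (L₀ ▷ gs) width-≤)
    p : Fin r
    p = proj₁ (available j)
    p≋j : topVal (lv′ lv) layers′ p ≋ topVal lv (L₀ ▷ gs) j
    p≋j = proj₂ (available j)
    w≥1 : 1 ≤ w
    w≥1 = ≤-trans (≤-trans (s≤s z≤n) (toℕ<n j)) (≤-trans (m≤n⊔m _ k) width-≤)

lemma1 : ∃ℕω λ K →
    ∀ {c ℓ} (F : Field c ℓ) (comm : Bool) (n : ℕ) (C : Circuits.Circuit F n) →
      Σ (Circuits.Circuit F n) λ C′ →
        Circuits.Staggered F n C′
        × Circuits.width F n C′ ≤ suc (Circuits.width F n C)
        × Circuits.size F n C′ ≤ K * (Circuits.width F n C * Circuits.size F n C) + K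
        × SamePoly F n comm (Circuits.computes F n C′) (Circuits.computes F n C)
lemma1 = 2 ,ω λ F comm n → Staggering.stagger F comm n
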